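{- For integers $x\le y$ write $[x,y]=\{n\in\mathbb{Z}: x\le n\le y\}$. For $k\ge 1$ let \[ c_k=4\cdot 5^{k-1},\qquad B_k=[5\cdot 5^{k-1},\,6\cdot 5^{k-1}-1],\qquad F_k=[10\cdot 5^{k-1}-1,\,15\cdot 5^{k-1}], \] and for $k\ge 0$ let \[ A_k=[2,3]\cup\bigcup_{i=1}^{k}\bigl(\{c_i\}\cup B_i\cup F_i\bigr). \] Then for every $k\ge 0$, \[ [4,\,6\cdot 5^k]\subseteq A_k+A_k. \]
   Context: For a set $S$ of integers, $S+S=\{s+t: s,t\in S\}$. -}

module Defs where

open import Data.Nat using (ℕ; zero; suc)
open import Data.Integer using (ℤ; +_; _+_; _*_; _-_; _≤_; _^_)
open import Data.Product using (Σ; _×_; ∃₂)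
open import Data.Sum using (_⊎_)
open import Relation.Binary.PropositionalEquality using (_≡_)

Set⊆ℤ : Set₁
Set⊆ℤ = ℤ → Set

[_,_] : ℤ → ℤ → Set⊆ℤ
[ x , y ] n = x ≤ n × n ≤ y

_⊕_ : Set⊆ℤ → Set⊆ℤ → Set⊆ℤ
(S ⊕ T) n = ∃₂ λ s t → S s × T t × n ≡ s + t

_⊆_ : Set⊆ℤ → Set⊆ℤ → Set
S ⊆ T = ∀ n → S n → T n

-- 5^(k-1) for k ≥ 1, written with i = k - 1, so index k = suc i.
p5 : ℕ → ℤ
p5 i = (+ 5) ^ i

c : ℕ → ℤ
c i = + 4 * p5 i

B : ℕ → Set⊆ℤ
B i = [ + 5 * p5 i , + 6 * p5 i - + 1 ]

F : ℕ → Set⊆ℤ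
F i = [ + 10 * p5 i - + 1 , + 15 * p5 i ]

A : ℕ → Set⊆ℤ
A zero n = [ + 2 , + 3 ] n
A (suc k) n = A k n ⊎ (n ≡ c k ⊎ B k n ⊎ F k n)

{-# OPTIONS --safe #-}
module Submission where

-- For k ≥ 1 put
-- q = 5^k. Then A_{k+1} contains 2, q ∈ B_k, 4q = c_{k+1}, F_k = [2q−1, 3q],
-- B_{k+1} = [5q, 6q−1] and F_{k+1} = [10q−1, 15q], and the translates
--   q + B_{k+1}, 5q + F_k, 3q + B_{k+1}, 4q + B_{k+1}, 5q + B_{k+1},
--   2 + F_{k+1}, 4q + F_{k+1}, 5q + F_{k+1}, 10q + F_{k+1}, 15q + F_{k+1}
-- each begin at most one past the end of the previous one, so together with [4, 6q]
-- they cover [4, 30q] = [4, 6·5^{k+1}].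

open import Defs
open import Data.Nat using (ℕ; zero; suc)
import Data.Nat as ℕ
import Data.Nat.Properties as ℕ
open import Data.Integer using (ℤ; +_; _*_; _^_; _+_; _-_; -_; _≤_; _≤?_; 0ℤ; 1ℤ; -1ℤ; +≤+)
  renaming (suc to sucℤ)
open import Data.Integer.Properties
  using (≤-refl; ≤-trans; ≤-reflexive; ≤-antisym; ≰⇒>; i<j⇒suc[i]≤j; +-monoˡ-≤; +-monoʳ-≤;
         *-monoˡ-≤-nonNeg; *-identityˡ; *-identityʳ; +-identityʳ; *-assoc)
open import Data.Integer.Tactic.RingSolver using (solve-∀)
open import Data.Product using (_,_)
open import Data.Sum using (inj₁; inj₂)
open import Function using (_∘_; id; _$_)
open import Relation.Nullary using (yes; no)
open import Relation.Nullary.Decidable using (True; toWitness)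
open import Relation.Binary.PropositionalEquality using (_≡_; refl; sym; trans; cong; subst; subst₂)

variable
  S S′ T T′ U : Set⊆ℤ
  a x x′ y y′ z w : ℤ

⊆-trans : S ⊆ T → T ⊆ U → S ⊆ U
⊆-trans S⊆T T⊆U n = T⊆U n ∘ S⊆T n

interval-≡ : x ≡ x′ → y ≡ y′ → [ x , y ] ⊆ [ x′ , y′ ]
interval-≡ refl refl _ = id

interval-singleton : [ x , x ] ⊆ (_≡ x)
interval-singleton n (x≤n , n≤x) = ≤-antisym n≤x x≤n

∈-interval : ∀ {x n y} {x≤n : True (x ≤? n)} {n≤y : True (n ≤? y)} → [ x , y ] n
∈-interval {x≤n = x≤n} {n≤y} = toWitness x≤n , toWitness n≤y

interval-∪ : [ x , y ] ⊆ S → z ≤ sucℤ y → [ z , w ] ⊆ S → [ x , w ] ⊆ S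
interval-∪ {y = y} I⊆S z≤1+y J⊆S n (x≤n , n≤w) with n ≤? y
... | yes n≤y = I⊆S n (x≤n , n≤y)
... | no  n≰y = J⊆S n (≤-trans z≤1+y (i<j⇒suc[i]≤j (≰⇒> n≰y)) , n≤w)

infixl 4 _∪_
_∪_ : [ x , y ] ⊆ S → {True (z ≤? sucℤ y)} → [ z , w ] ⊆ S → [ x , w ] ⊆ S
_∪_ I⊆S {z≤1+y} J⊆S = interval-∪ I⊆S (toWitness z≤1+y) J⊆S

⊕-mono : S ⊆ S′ → T ⊆ T′ → (S ⊕ T) ⊆ (S′ ⊕ T′)
⊕-mono S⊆S′ T⊆T′ n (s , t , s∈S , t∈T , n≡s+t) = s , t , S⊆S′ s s∈S , T⊆T′ t t∈T , n≡s+t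

⊕-translate : S a → [ x , y ] ⊆ T → [ a + x , a + y ] ⊆ (S ⊕ T)
⊕-translate {a = a} {x = x} {y = y} a∈S I⊆T n (a+x≤n , n≤a+y) =
  a , n - a , a∈S , I⊆T (n - a) (x≤n-a , n-a≤y) , n≡a+[n-a] a n
  where
  n≡a+[n-a] : ∀ a n → n ≡ a + (n - a)
  n≡a+[n-a] = solve-∀
  a+b-a≡b : ∀ a b → a + b - a ≡ b
  a+b-a≡b = solve-∀
  x≤n-a : x ≤ n - a
  x≤n-a = subst (_≤ n - a) (a+b-a≡b a x) (+-monoˡ-≤ (- a) a+x≤n)
  n-a≤y : n - a ≤ y
  n-a≤y = subst (n - a ≤_) (a+b-a≡b a y) (+-monoˡ-≤ (- a) n≤a+y)

-- ⟨ m , b ⟩ stands for m·q + b. It is opaque so that unification recovers m and b, after which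
-- the side conditions of ⟨⟩-≤ and _∪⟨⟩_ are closed decidable facts discharged by evaluation.
module Linear (q : ℤ) (1≤q : 1ℤ ≤ q) where

  opaque
    ⟨_,_⟩ : ℕ → ℤ → ℤ
    ⟨ m , b ⟩ = + m * q + b

    fold-⟨⟩ : ∀ m b → + m * q + b ≡ ⟨ m , b ⟩
    fold-⟨⟩ m b = refl

    ⟨⟩-+ : ∀ m b n d → ⟨ m , b ⟩ + ⟨ n , d ⟩ ≡ ⟨ m ℕ.+ n , b + d ⟩
    ⟨⟩-+ m b n d = regroup (+ m) b (+ n) d q
      where
      regroup : ∀ m b n d q → m * q + b + (n * q + d) ≡ (m + n) * q + (b + d)
      regroup = solve-∀

    ⟨⟩-suc : ∀ m b → ⟨ m , b + 1ℤ ⟩ ≡ sucℤ ⟨ m , b ⟩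
    ⟨⟩-suc m b = regroup (+ m) b q
      where
      regroup : ∀ m b q → m * q + (b + 1ℤ) ≡ 1ℤ + (m * q + b)
      regroup = solve-∀

    ⟨⟩-≤ : ∀ {m b n d} {m≤n : True (m ℕ.≤? n)} {b≤d+e : True (b ≤? d + + (n ℕ.∸ m))} →
           ⟨ m , b ⟩ ≤ ⟨ n , d ⟩
    ⟨⟩-≤ {m} {b} {n} {d} {m≤n} {b≤d+e} =
      ≤-trans (+-monoʳ-≤ (+ m * q) b≤d+e·q) (≤-reflexive (trans (regroup (+ m) (+ e) d q) m+e≡n))
      where
      e : ℕ
      e = n ℕ.∸ m
      m+e≡n : ⟨ m ℕ.+ e , d ⟩ ≡ ⟨ n , d ⟩
      m+e≡n = cong ⟨_, d ⟩ (ℕ.m+[n∸m]≡n (toWitness m≤n))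
      e≤e·q : + e ≤ + e * q
      e≤e·q = subst (_≤ + e * q) (*-identityʳ (+ e)) (*-monoˡ-≤-nonNeg (+ e) 1≤q)
      b≤d+e·q : b ≤ d + + e * q
      b≤d+e·q = ≤-trans (toWitness b≤d+e) (+-monoʳ-≤ d e≤e·q)
      regroup : ∀ m e d q → m * q + (d + e * q) ≡ (m + e) * q + d
      regroup = solve-∀

  fold-⟨⟩₀ : ∀ m → + m * q ≡ ⟨ m , 0ℤ ⟩
  fold-⟨⟩₀ m = subst (_≡ ⟨ m , 0ℤ ⟩) (+-identityʳ (+ m * q)) (fold-⟨⟩ m 0ℤ)

  ⊕-translate-⟨⟩ : ∀ {m b n d n′ d′} → S ⟨ m , b ⟩ → [ ⟨ n , d ⟩ , ⟨ n′ , d′ ⟩ ] ⊆ T →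
                   [ ⟨ m ℕ.+ n , b + d ⟩ , ⟨ m ℕ.+ n′ , b + d′ ⟩ ] ⊆ (S ⊕ T)
  ⊕-translate-⟨⟩ {m = m} {b} {n} {d} {n′} {d′} a∈S I⊆T =
    ⊆-trans (interval-≡ (sym (⟨⟩-+ m b n d)) (sym (⟨⟩-+ m b n′ d′))) (⊕-translate a∈S I⊆T)

  infixl 4 _∪⟨⟩_
  _∪⟨⟩_ : ∀ {m b n d} → [ x , ⟨ n , b ⟩ ] ⊆ S →
          {True (m ℕ.≤? n)} → {True (d ≤? b + 1ℤ + + (n ℕ.∸ m))} →
          [ ⟨ m , d ⟩ , w ] ⊆ S → [ x , w ] ⊆ S
  _∪⟨⟩_ {b = b} {n = n} I⊆S {m≤n} {d≤b+1+n-m} J⊆S =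
    interval-∪ I⊆S (≤-trans (⟨⟩-≤ {m≤n = m≤n} {b≤d+e = d≤b+1+n-m}) (≤-reflexive (⟨⟩-suc n b))) J⊆S

  sumset-step-⟨⟩ : ∀ {S} → S ⟨ 0 , + 2 ⟩ → S ⟨ 1 , 0ℤ ⟩ → S ⟨ 4 , 0ℤ ⟩ →
                   [ ⟨ 2 , -1ℤ ⟩ , ⟨ 3 , 0ℤ ⟩ ] ⊆ S →
                   [ ⟨ 5 , 0ℤ ⟩ , ⟨ 6 , -1ℤ ⟩ ] ⊆ S →
                   [ ⟨ 10 , -1ℤ ⟩ , ⟨ 15 , 0ℤ ⟩ ] ⊆ S →
                   [ + 4 , ⟨ 6 , 0ℤ ⟩ ] ⊆ (S ⊕ S) → [ + 4 , ⟨ 30 , 0ℤ ⟩ ] ⊆ (S ⊕ S)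
  sumset-step-⟨⟩ {S} 2∈S q∈S 4q∈S I⊆S B⊆S F⊆S [4,6q]⊆S⊕S =
    [4,6q]⊆S⊕S
      ∪⟨⟩ ⊕-translate-⟨⟩ q∈S   B⊆S
      ∪⟨⟩ ⊕-translate-⟨⟩ 5q∈S  I⊆S
      ∪⟨⟩ ⊕-translate-⟨⟩ 3q∈S  B⊆S
      ∪⟨⟩ ⊕-translate-⟨⟩ 4q∈S  B⊆S
      ∪⟨⟩ ⊕-translate-⟨⟩ 5q∈S  B⊆S
      ∪⟨⟩ ⊕-translate-⟨⟩ 2∈S   F⊆S
      ∪⟨⟩ ⊕-translate-⟨⟩ 4q∈S  F⊆S
      ∪⟨⟩ ⊕-translate-⟨⟩ 5q∈S  F⊆S
      ∪⟨⟩ ⊕-translate-⟨⟩ 10q∈S F⊆S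
      ∪⟨⟩ ⊕-translate-⟨⟩ 15q∈S F⊆S
    where
    3q∈S : S ⟨ 3 , 0ℤ ⟩
    3q∈S = I⊆S _ (⟨⟩-≤ , ⟨⟩-≤)
    5q∈S : S ⟨ 5 , 0ℤ ⟩
    5q∈S = B⊆S _ (⟨⟩-≤ , ⟨⟩-≤)
    10q∈S : S ⟨ 10 , 0ℤ ⟩
    10q∈S = F⊆S _ (⟨⟩-≤ , ⟨⟩-≤)
    15q∈S : S ⟨ 15 , 0ℤ ⟩
    15q∈S = F⊆S _ (⟨⟩-≤ , ⟨⟩-≤)

sumset-step : ∀ q → 1ℤ ≤ q → S (+ 2) → S q → S (+ 4 * q) →
              [ + 2 * q - + 1 , + 3 * q ] ⊆ S →
              [ + 5 * q , + 6 * q - + 1 ] ⊆ S →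
              [ + 10 * q - + 1 , + 15 * q ] ⊆ S →
              [ + 4 , + 6 * q ] ⊆ (S ⊕ S) → [ + 4 , + 30 * q ] ⊆ (S ⊕ S)
sumset-step {S} q 1≤q 2∈S q∈S 4q∈S I⊆S B⊆S F⊆S [4,6q]⊆S⊕S =
  ⊆-trans (interval-≡ refl (fold-⟨⟩₀ 30)) $
    sumset-step-⟨⟩ (subst S (fold-⟨⟩ 0 (+ 2)) 2∈S)
                   (subst S (subst (_≡ ⟨ 1 , 0ℤ ⟩) (*-identityˡ q) (fold-⟨⟩₀ 1)) q∈S)
                   (subst S (fold-⟨⟩₀ 4) 4q∈S)
                   (⊆-trans (interval-≡ (sym (fold-⟨⟩ 2 -1ℤ)) (sym (fold-⟨⟩₀ 3))) I⊆S)
                   (⊆-trans (interval-≡ (sym (fold-⟨⟩₀ 5)) (sym (fold-⟨⟩ 6 -1ℤ))) B⊆S)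
                   (⊆-trans (interval-≡ (sym (fold-⟨⟩ 10 -1ℤ)) (sym (fold-⟨⟩₀ 15))) F⊆S)
                   (⊆-trans (interval-≡ refl (sym (fold-⟨⟩₀ 6))) [4,6q]⊆S⊕S)
  where open Linear q 1≤q

1≤p5 : ∀ i → 1ℤ ≤ p5 i
1≤p5 zero    = +≤+ ℕ.≤-refl
1≤p5 (suc i) = ≤-trans (+≤+ (ℕ.s≤s ℕ.z≤n)) (*-monoˡ-≤-nonNeg (+ 5) (1≤p5 i))

p5-suc∈B : ∀ i → B i (p5 (suc i))
p5-suc∈B i = ≤-refl , subst₂ _≤_ (sym (fold-⟨⟩₀ 5)) (sym (fold-⟨⟩ 6 -1ℤ)) ⟨⟩-≤
  where open Linear (p5 i) (1≤p5 i)

F-rescaled : ∀ i → [ + 2 * p5 (suc i) - + 1 , + 3 * p5 (suc i) ] ⊆ F i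
F-rescaled i = interval-≡ (cong (_- + 1) (sym (*-assoc (+ 2) (+ 5) (p5 i))))
                          (sym (*-assoc (+ 3) (+ 5) (p5 i)))

A-⊆-suc : ∀ {k} → A k ⊆ A (suc k)
A-⊆-suc _ = inj₁

A₀⊆A : ∀ k → A 0 ⊆ A k
A₀⊆A zero    = λ _ → id
A₀⊆A (suc k) = ⊆-trans (A₀⊆A k) A-⊆-suc

c∈A : ∀ i → A (suc i) (c i)
c∈A _ = inj₂ (inj₁ refl)

B⊆A : ∀ i → B i ⊆ A (suc i)
B⊆A _ _ = inj₂ ∘ inj₂ ∘ inj₁

F⊆A : ∀ i → F i ⊆ A (suc i)
F⊆A _ _ = inj₂ ∘ inj₂ ∘ inj₂

[2,5]⊆A₁ : [ + 2 , + 5 ] ⊆ A 1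
[2,5]⊆A₁ = A₀⊆A 1 ∪ (λ n → inj₂ ∘ inj₁ ∘ interval-singleton n) ∪ B⊆A 0

lemma3p2 : (k : ℕ) → [ + 4 , + 6 * (+ 5) ^ k ] ⊆ (A k ⊕ A k)
lemma3p2 zero =
  ⊕-translate {a = + 2} ∈-interval (λ _ → id) ∪ ⊕-translate {a = + 3} ∈-interval (λ _ → id)
lemma3p2 (suc zero) =
  ⊕-translate ([2,5]⊆A₁ (+ 2) ∈-interval) [2,5]⊆A₁ ∪ ⊕-translate ([2,5]⊆A₁ (+ 5) ∈-interval) [2,5]⊆A₁
    ∪ ⊕-translate ([2,5]⊆A₁ (+ 2) ∈-interval) (F⊆A 0) ∪ ⊕-translate (F⊆A 0 (+ 9) ∈-interval) (F⊆A 0)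
    ∪ ⊕-translate (F⊆A 0 (+ 15) ∈-interval) (F⊆A 0)
lemma3p2 (suc (suc i)) =
  ⊆-trans (interval-≡ refl (sym (*-assoc (+ 6) (+ 5) q))) $
    sumset-step q (1≤p5 (suc i))
      (A₀⊆A (2 ℕ.+ i) (+ 2) ∈-interval) (A-⊆-suc _ (B⊆A i _ (p5-suc∈B i))) (c∈A (suc i))
      (⊆-trans (F-rescaled i) (⊆-trans (F⊆A i) A-⊆-suc)) (B⊆A (suc i)) (F⊆A (suc i))
      (⊆-trans (lemma3p2 (suc i)) (⊕-mono A-⊆-suc A-⊆-suc))
  where
  q : ℤ
  q = p5 (suc i)
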